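{- Let $Sys=(V,I,T)$ be a Boolean transition system and $P$ a safety property (a Boolean formula over $V$). Then $Sys$ is safe for $P$ if and only if there exists an $F$-sequence $(F_0,\ldots,F_n)$ for $Sys$ and $P$ such that for every $B$-sequence $(B_0,\ldots,B_k)$ for $Sys$ and $P$ we have $S(F)\cap R^{ -1}(S(B))=\emptyset$, where $S(F)=\bigcup_{0\leq j\leq n}F_j$ and $S(B)=\bigcup_{0\leq j\leq k}B_j$.
   Context: A Boolean transition system is a tuple $Sys=(V,I,T)$ where $V$ is a finite set of Boolean variables, the states are the truth assignments in $2^V$, $I$ is a Boolean formula over $V$ describing the set of initial states, and $T$ is a Boolean formula over $V\cup V'$ ($V'$ a primed copy of $V$) describing the transition relation: $(s_1,s_2)\in T$ iff $s_1\cup s_2'\models T$. Formulas over $V$ are identified with the sets of states satisfying them; $\neg P$ denotes the set of states violating $P$. A path is a finite sequence of states $s_1,\ldots,s_k$ ($k\geq1$) with $(s_m,s_{m+1})\in T$ for all $m<k$; $t$ is reachable from $s$ if there is a path from $s$ to $t$. For a set of states $X$, $R(X)=\{s'\mid (s,s')\in T,\ s\in X\}$ and $R^{ -1}(X)=\{s\mid (s,s')\in T,\ s'\in X\}$. $Sys$ is safe for $P$ if every state reachable from some initial state satisfies $P$. An $F$-sequence is a finite sequence $(F_0,\ldots,F_n)$ ($n\geq0$) of sets of states with $F_0=I$, $F_j\subseteq P$ for all $j$, and $F_{j+1}\supseteq R(F_j)$ for all $0\le j<n$. A $B$-sequence is a finite sequence $(B_0,\ldots,B_k)$ ($k\geq0$)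 of sets of states with $B_0=\neg P$ and $B_{j+1}\subseteq R^{ -1}(B_j)$ for all $0\le j<k$. -}

module Defs where

open import Level using (0ℓ)
open import Data.Bool using (Bool; true; false; not; _∧_; _∨_)
open import Data.Nat using (ℕ; suc)
open import Data.Fin using (Fin; zero; suc; inject₁)
open import Data.Sum using (_⊎_; [_,_])
open import Data.Product using (Σ; ∃; _×_)
open import Relation.Binary.PropositionalEquality using (_≡_)
open import Relation.Unary using (Pred; _⊆_; _≐_; ∁)
open import Relation.Binary.Construct.Closure.ReflexiveTransitive using (Star)

data Formula (X : Set) : Set where
  tt ff : Formula X
  var   : X → Formula X
  ¬ᶠ_   : Formula X → Formula X
  _∧ᶠ_ _∨ᶠ_ : Formula X → Formula X → Formula X

⟦_⟧ : {X : Set} → Formula X → (X → Bool) → Bool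
⟦ tt ⟧ ρ = true
⟦ ff ⟧ ρ = false
⟦ var x ⟧ ρ = ρ x
⟦ ¬ᶠ φ ⟧ ρ = not (⟦ φ ⟧ ρ)
⟦ φ ∧ᶠ ψ ⟧ ρ = ⟦ φ ⟧ ρ ∧ ⟦ ψ ⟧ ρ
⟦ φ ∨ᶠ ψ ⟧ ρ = ⟦ φ ⟧ ρ ∨ ⟦ ψ ⟧ ρ

-- V = Fin m; states are truth assignments 2^V
State : ℕ → Set
State m = Fin m → Bool

StateSet : ℕ → Set₁
StateSet m = Pred (State m) 0ℓ

Sat : {m : ℕ} → Formula (Fin m) → StateSet m
Sat φ s = ⟦ φ ⟧ s ≡ true

-- Boolean transition system (V, I, T); V' is the right copy of Fin m
record TransitionSystem (m : ℕ) : Set where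
  field
    I : Formula (Fin m)
    T : Formula (Fin m ⊎ Fin m)

module _ {m : ℕ} (Sys : TransitionSystem m) where
  open TransitionSystem Sys

  Trans : State m → State m → Set
  Trans s₁ s₂ = ⟦ T ⟧ [ s₁ , s₂ ] ≡ true

  Reachable : State m → State m → Set
  Reachable = Star Trans

  Safe : Formula (Fin m) → Set
  Safe P = ∀ s t → Sat I s → Reachable s t → Sat P t

  R : StateSet m → StateSet m
  R X s′ = ∃ λ s → X s × Trans s s′

  R⁻¹ : StateSet m → StateSet m
  R⁻¹ X s = ∃ λ s′ → X s′ × Trans s s′

  record FSequence (P : Formula (Fin m)) : Set₁ where
    field
      n     : ℕ
      F     : Fin (suc n) → StateSet m
      init  : F zero ≐ Sat I
      inP   : ∀ j → F j ⊆ Sat P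
      step  : ∀ (j : Fin n) → R (F (inject₁ j)) ⊆ F (suc j)

  record BSequence (P : Formula (Fin m)) : Set₁ where
    field
      k     : ℕ
      B     : Fin (suc k) → StateSet m
      init  : B zero ≐ ∁ (Sat P)
      step  : ∀ (j : Fin k) → B (suc j) ⊆ R⁻¹ (B (inject₁ j))

  S-F : {P : Formula (Fin m)} → FSequence P → StateSet m
  S-F 𝐅 s = ∃ λ j → FSequence.F 𝐅 j s

  S-B : {P : Formula (Fin m)} → BSequence P → StateSet m
  S-B 𝐁 s = ∃ λ j → BSequence.B 𝐁 j s

module Submission where

open import Defs
open import Data.Nat using (ℕ; zero; suc)
open import Data.Nat.Properties using (suc-injective)
open import Data.Fin using (Fin; zero; suc; inject₁; toℕ; fromℕ)
open import Data.Fin.Properties using (toℕ-inject₁; toℕ-fromℕ)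
open import Data.Bool using (true) renaming (_≟_ to _≟ᵇ_)
open import Data.Product using (Σ; ∃; _×_; _,_; proj₁; proj₂)
open import Relation.Nullary using (¬_)
open import Relation.Nullary.Decidable using (decidable-stable)
open import Relation.Unary using (Empty; _∩_; _⊆_; ∁)
open import Relation.Binary.PropositionalEquality using (_≡_; refl; sym; trans; subst)
open import Relation.Binary.Construct.Closure.ReflexiveTransitive using (ε; _◅_)
open import Function.Bundles using (_⇔_; mk⇔)

-- Every state of Bⱼ reaches a state violating P in exactly j steps, so for a safe
-- system the trivial F-sequence (I) works. Conversely, the iterated preimages of ¬P form a
-- B-sequence of any length; if some initial state reached ¬P in n + 1 steps, its successor would
-- lie in the n-th of them, and a path of length 0 is excluded by F₀ ⊆ P.

module _ {m : ℕ} (Sys : TransitionSystem m) where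
  open TransitionSystem Sys

  R⁻¹-iterate : ℕ → StateSet m → StateSet m
  R⁻¹-iterate zero    X = X
  R⁻¹-iterate (suc n) X = R⁻¹ Sys (R⁻¹-iterate n X)

  R⁻¹-iterate⇒reaches : ∀ n {X s} → R⁻¹-iterate n X s → ∃ λ t → Reachable Sys s t × X t
  R⁻¹-iterate⇒reaches zero    {s = s} x = s , ε , x
  R⁻¹-iterate⇒reaches (suc n) (s′ , x′ , tr) with R⁻¹-iterate⇒reaches n x′
  ... | t , path , x = t , tr ◅ path , x

  reaches⇒R⁻¹-iterate : ∀ {X s t} → Reachable Sys s t → X t → ∃ λ n → R⁻¹-iterate n X s
  reaches⇒R⁻¹-iterate ε x = zero , x
  reaches⇒R⁻¹-iterate (tr ◅ path) x with reaches⇒R⁻¹-iterate path x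
  ... | n , x′ = suc n , (_ , x′ , tr)

  module _ (P : Formula (Fin m)) where

    BSequence⊆R⁻¹-iterate : (𝐁 : BSequence Sys P) → ∀ n j → toℕ j ≡ n →
                            BSequence.B 𝐁 j ⊆ R⁻¹-iterate n (∁ (Sat P))
    BSequence⊆R⁻¹-iterate 𝐁 zero    zero    _  = proj₁ (BSequence.init 𝐁)
    BSequence⊆R⁻¹-iterate 𝐁 (suc n) (suc j) eq b with BSequence.step 𝐁 j b
    ... | s′ , b′ , tr = s′ , BSequence⊆R⁻¹-iterate 𝐁 n (inject₁ j) j≡n b′ , tr
      where
      j≡n : toℕ (inject₁ j) ≡ n
      j≡n = trans (toℕ-inject₁ j) (suc-injective eq)

    maximalBSequence : ℕ → BSequence Sys P
    maximalBSequence k = record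
      { k    = k
      ; B    = λ j → R⁻¹-iterate (toℕ j) (∁ (Sat P))
      ; init = (λ x → x) , (λ x → x)
      ; step = λ { j (s′ , x , tr) →
                 s′ , subst (λ i → R⁻¹-iterate i (∁ (Sat P)) s′) (sym (toℕ-inject₁ j)) x , tr }
      }

    R⁻¹-S-B⇒R⁻¹-iterate : (𝐁 : BSequence Sys P) → ∀ {s} → R⁻¹ Sys (S-B Sys 𝐁) s →
                          ∃ λ n → R⁻¹-iterate (suc n) (∁ (Sat P)) s
    R⁻¹-S-B⇒R⁻¹-iterate 𝐁 (s′ , (j , b) , tr) =
      toℕ j , s′ , BSequence⊆R⁻¹-iterate 𝐁 (toℕ j) j refl b , tr

    R⁻¹-iterate⊆R⁻¹-S-B : ∀ n → R⁻¹-iterate (suc n) (∁ (Sat P)) ⊆ R⁻¹ Sys (S-B Sys (maximalBSequence n))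
    R⁻¹-iterate⊆R⁻¹-S-B n (s′ , x , tr) =
      s′ , (fromℕ n , subst (λ i → R⁻¹-iterate i (∁ (Sat P)) s′) (sym (toℕ-fromℕ n)) x) , tr

    initialFSequence : Safe Sys P → FSequence Sys P
    initialFSequence safe = record
      { n    = zero
      ; F    = λ _ → Sat I
      ; init = (λ x → x) , (λ x → x)
      ; inP  = λ { zero {s} i → safe s s i ε }
      ; step = λ ()
      }

    safe-if-no-violation-reachable : (∀ {s t} → Sat I s → Reachable Sys s t → ¬ ¬ Sat P t) → Safe Sys P
    safe-if-no-violation-reachable h s t i path = decidable-stable (⟦ P ⟧ t ≟ᵇ true) (h i path)

    Separated : Set₁
    Separated = Σ (FSequence Sys P) (λ 𝐅 → (𝐁 : BSequence Sys P) →
                  Empty (S-F Sys 𝐅 ∩ R⁻¹ Sys (S-B Sys 𝐁)))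

    safe⇒separated : Safe Sys P → Separated
    safe⇒separated safe = initialFSequence safe , separated
      where
      separated : ∀ 𝐁 → Empty (S-F Sys (initialFSequence safe) ∩ R⁻¹ Sys (S-B Sys 𝐁))
      separated 𝐁 s ((zero , i) , s∈R⁻¹B) with R⁻¹-S-B⇒R⁻¹-iterate 𝐁 s∈R⁻¹B
      ... | n , x with R⁻¹-iterate⇒reaches (suc n) x
      ... | t , path , t∉P = t∉P (safe s t i path)

    separated⇒safe : Separated → Safe Sys P
    separated⇒safe (𝐅 , separated) = safe-if-no-violation-reachable noViolation
      where
      open FSequence 𝐅
      noViolation : ∀ {s t} → Sat I s → Reachable Sys s t → ¬ ¬ Sat P t
      noViolation i ε t∉P = t∉P (inP zero (proj₂ init i))
      noViolation {s} i (tr ◅ path) t∉P with reaches⇒R⁻¹-iterate path t∉P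
      ... | n , x = separated (maximalBSequence n) s
                      ((zero , proj₂ init i) , R⁻¹-iterate⊆R⁻¹-S-B n (_ , x , tr))

mainTheorem3 : (m : ℕ) (Sys : TransitionSystem m) (P : Formula (Fin m)) →
    Safe Sys P ⇔
      Σ (FSequence Sys P) (λ 𝐅 → (𝐁 : BSequence Sys P) →
        Empty (S-F Sys 𝐅 ∩ R⁻¹ Sys (S-B Sys 𝐁)))
mainTheorem3 m Sys P = mk⇔ (safe⇒separated Sys P) (separated⇒safe Sys P)
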